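{- Let $p\ge 2$ and $r\ge 1$ be integers. Suppose $(A_{j1},\dots,A_{jp})$, for $j=1,\dots,m$, are $m$ distinct weak set compositions into $p$ parts such that for every $k\in[p]$ and every $I\subseteq[m]$ with $|I|=r+1$ there exist distinct $i,j\in I$ such that either $A_{ik}=A_{jk}$ or \[ A_{ik}\cap \bigcup_{l\neq k} A_{jl}\neq\emptyset\neq A_{jk}\cap\bigcup_{l\neq k}A_{il}. \] Then \[ \sum_{j=1}^m \frac{1}{\binom{|A_{j1}|+\dots+|A_{jp}|}{|A_{j1}|,\dots,|A_{jp}|}}\le r^p . \]
   Context: A weak set composition into $p$ parts is an ordered $p$-tuple $(A_1,\dots,A_p)$ of pairwise disjoint finite sets, each possibly empty. $[p]=\{1,\dots,p\}$. $\binom{a_1+\dots+a_p}{a_1,\dots,a_p}$ denotes the multinomial coefficient $\frac{(a_1+\dots+a_p)!}{a_1!\cdots a_p!}$. -}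

module Defs where

open import Data.Nat using (ℕ; zero; suc; _+_; _*_; NonZero)
open import Data.Nat.Combinatorics using ()
open import Data.Nat.Base using (_!)
open import Data.Nat.Properties using (_!≢0)
open import Data.Fin using (Fin; zero; suc)
open import Data.Fin.Subset using (Subset; ⊥; _∩_; _∪_; ∣_∣)
open import Data.Integer using (+_)
open import Data.Rational using (ℚ; 0ℚ; _/_) renaming (_+_ to _+ℚ_)
open import Relation.Binary.PropositionalEquality using (_≡_; _≢_)
open import Relation.Nullary using (Dec; yes; no)
open import Data.Fin using (_≟_)

sumℕ : ∀ {p} → (Fin p → ℕ) → ℕ
sumℕ {zero}  a = 0
sumℕ {suc p} a = a zero + sumℕ (λ i → a (suc i))

prodℕ : ∀ {p} → (Fin p → ℕ) → ℕ
prodℕ {zero}  a = 1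
prodℕ {suc p} a = a zero * prodℕ (λ i → a (suc i))

sumℚ : ∀ {m} → (Fin m → ℚ) → ℚ
sumℚ {zero}  f = 0ℚ
sumℚ {suc m} f = f zero +ℚ sumℚ (λ i → f (suc i))

invMultinomial : ∀ {p} → (Fin p → ℕ) → ℚ
invMultinomial a = _/_ (+ prodℕ (λ i → a i !)) (sumℕ a !) {{(sumℕ a) !≢0}}

IsWeakSetComposition : ∀ {n p} → (Fin p → Subset n) → Set
IsWeakSetComposition {n} A = ∀ k l → k ≢ l → A k ∩ A l ≡ ⊥

unionAll : ∀ {n p} → (Fin p → Subset n) → Subset n
unionAll {n} {zero}  B = ⊥
unionAll {n} {suc p} B = B zero ∪ unionAll (λ i → B (suc i))

unionExcept : ∀ {n p} → Fin p → (Fin p → Subset n) → Subset n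
unionExcept k B = unionAll (λ l → pick (l ≟ k) (B l))
  where
    pick : ∀ {n} {P : Set} → Dec P → Subset n → Subset n
    pick (yes _) _ = ⊥
    pick (no _)  S = S

{-# OPTIONS --safe #-}
module Submission where

-- Call an ordering of the ground set Fin n compatible with a weak set composition (A₁, …, A_p) if
-- it lists the elements of A_p first, then those of A_{p-1}, …, then those of A₁, the elements in no
-- part being placed anywhere; n! / multinomial(|A₁|, …, |A_p|) orderings are compatible with it.
-- Compositions compatible with a common ordering never cross: there are no x, y with x in a lower
-- part than y in one of them and in a higher part in the other.  For such compositions agreeing on
-- A₁, …, A_{k-1} the overlaps allowed by the hypothesis would produce a crossing, so among any r + 1
-- of them two have the same k-th part; peeling off one part at a time, at most r^p of the given
-- compositions are compatible with any one ordering.  Counting pairs (ordering, compatible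
-- composition) in two ways gives Σⱼ n! / multinomialⱼ ≤ n! r^p.

open import Defs

-- A separate module, so that ℕ's _≤_ does not clash with ℚ's in the statement.
module Counting where

  open import Level using (Level; 0ℓ)
  open import Data.Nat.Properties using (+-*-semiring)
  open import Algebra.Properties.Semiring.Sum +-*-semiring
    using (sum-syntax; ∑-comm; ∑-distrib-+; *-distribˡ-sum; *-distribʳ-sum; sum-cong-≗; sum-replicate-zero)
  open import Data.Bool.Base using (true; false; if_then_else_; _∧_)
  import Data.Bool.Properties as Bool
  open import Data.Fin.Base as Fin using (Fin; zero; suc)
  open import Data.Fin.Properties using (_≟_; _<?_; all?; any?; <-cmp; ≤∧≢⇒<)
  open import Data.Fin.Subset
    using (Subset; inside; outside; ⊤; ⊥; _∈_; _∉_; _⊆_; ∣_∣; _∩_; _∪_; _─_; _-_; ⁅_⁆; Empty; Nonempty)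
  open import Data.Fin.Subset.Properties
    using (_∈?_; x∈p∩q⁻; x∈p∩q⁺; x∈p∪q⁻; p─q⊆p; x∈p∧x≢y⇒x∈p-y; nonempty?; Empty-unique;
           ∣⊥∣≡0; ∣⁅x⁆∣≡1; ∣⊤∣≡n; p⊆q⇒∣p∣≤∣q∣; p─⊥≡p; ∪-identityʳ; ∉⊥; ∈⊤; x∈⁅x⁆; x∈⁅y⁆⇒x≡y)
  open import Data.Maybe.Base using (Maybe; just; nothing)
  import Data.Maybe.Properties as Maybe
  open import Data.Nat.Base using (ℕ; zero; suc; _+_; _*_; _^_; _≤_; z≤n; s≤s; _!)
  open import Data.Nat.Properties
    using (module ≤-Reasoning; +-identityʳ; *-identityˡ; *-identityʳ; *-zeroʳ; *-assoc; *-distribʳ-+; +-suc;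
           +-cancelˡ-≡; suc-injective; +-mono-≤; ≤-trans; ≤-reflexive; <⇒≱)
  open import Data.Nat.Tactic.RingSolver using (solve-∀)
  open import Data.Product.Base using (Σ; ∃; ∃₂; _×_; _,_; proj₁; proj₂)
  open import Data.Sum.Base using (_⊎_; inj₁; inj₂)
  open import Data.Vec.Base using (_∷_; []; here; there; tabulate)
  import Data.Vec.Properties as Vec
  open import Function.Base using (_∘_)
  open import Function.Bundles using (_⇔_; mk⇔)
  open import Relation.Binary.Definitions using (DecidableEquality; tri<; tri≈; tri>)
  open import Relation.Binary.PropositionalEquality
  open import Relation.Nullary.Decidable
    using (Dec; yes; no; does; _×-dec_; _⊎-dec_; _→-dec_; ¬?; map′; dec-true; dec-false; does-⇔)
  open import Relation.Nullary.Negation using (¬_; contradiction)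
  open import Relation.Unary using (Pred; Decidable)

  private
    variable
      ℓ ℓ′ : Level
      A : Set ℓ
      B : Set ℓ′
      m n p : ℕ

  𝟙 : Dec A → ℕ
  𝟙 a? = if does a? then 1 else 0

  𝟙-yes : (a? : Dec A) → A → 𝟙 a? ≡ 1
  𝟙-yes a? a = cong (if_then 1 else 0) (dec-true a? a)

  𝟙-no : (a? : Dec A) → ¬ A → 𝟙 a? ≡ 0
  𝟙-no a? ¬a = cong (if_then 1 else 0) (dec-false a? ¬a)

  𝟙-⇔ : A ⇔ B → (a? : Dec A) (b? : Dec B) → 𝟙 a? ≡ 𝟙 b?
  𝟙-⇔ A⇔B a? b? = cong (if_then 1 else 0) (does-⇔ A⇔B a? b?)

  𝟙-× : (a? : Dec A) (b? : Dec B) → 𝟙 (a? ×-dec b?) ≡ 𝟙 a? * 𝟙 b?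
  𝟙-× a? b? = lemma (does a?) (does b?)
    where
    lemma : ∀ x y → (if x ∧ y then 1 else 0) ≡ (if x then 1 else 0) * (if y then 1 else 0)
    lemma true  true  = refl
    lemma true  false = refl
    lemma false _     = refl

  𝟙-⊎ : (a? : Dec A) (b? : Dec B) → ¬ (A × B) → 𝟙 (a? ⊎-dec b?) ≡ 𝟙 a? + 𝟙 b?
  𝟙-⊎ (yes a) (yes b) ¬a×b = contradiction (a , b) ¬a×b
  𝟙-⊎ (yes _) (no _)  _    = refl
  𝟙-⊎ (no _)  (yes _) _    = refl
  𝟙-⊎ (no _)  (no _)  _    = refl

  𝟙*-cong : ∀ {x y} (a? : Dec A) → (A → x ≡ y) → 𝟙 a? * x ≡ 𝟙 a? * y
  𝟙*-cong (yes a) x≡y = cong (_+ 0) (x≡y a)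
  𝟙*-cong (no _)  _   = refl

  ∑-mono-≤ : {f g : Fin n → ℕ} → (∀ i → f i ≤ g i) → ∑[ i < n ] f i ≤ ∑[ i < n ] g i
  ∑-mono-≤ {zero}          f≤g = z≤n
  ∑-mono-≤ {suc n} {f} {g} f≤g = +-mono-≤ (f≤g zero) (∑-mono-≤ {f = f ∘ suc} {g ∘ suc} (f≤g ∘ suc))

  ∑-zero : {f : Fin n → ℕ} → (∀ i → f i ≡ 0) → ∑[ i < n ] f i ≡ 0
  ∑-zero {n} f≡0 = trans (sum-cong-≗ f≡0) (sum-replicate-zero n)

  ∑-𝟙≟* : (x : Fin n) (g : Fin n → ℕ) → ∑[ z < n ] (𝟙 (x ≟ z) * g z) ≡ g x
  ∑-𝟙≟* {suc n} zero    g =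
    trans (cong (_+_ (g zero + 0)) (sum-replicate-zero n)) (trans (+-identityʳ _) (+-identityʳ _))
  ∑-𝟙≟* {suc n} (suc x) g = ∑-𝟙≟* x (g ∘ suc)

  ∑-𝟙≟ : (x : Fin n) → ∑[ z < n ] 𝟙 (x ≟ z) ≡ 1
  ∑-𝟙≟ x = trans (sum-cong-≗ (λ z → sym (*-identityʳ (𝟙 (x ≟ z))))) (∑-𝟙≟* x (λ _ → 1))

  sumℕ≡∑ : (a : Fin p → ℕ) → sumℕ a ≡ ∑[ l < p ] a l
  sumℕ≡∑ {zero}  a = refl
  sumℕ≡∑ {suc p} a = cong (_+_ (a zero)) (sumℕ≡∑ (a ∘ suc))

  prodℕ-cong : {f g : Fin p → ℕ} → (∀ l → f l ≡ g l) → prodℕ f ≡ prodℕ g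
  prodℕ-cong {zero}  f≡g = refl
  prodℕ-cong {suc p} f≡g = cong₂ _*_ (f≡g zero) (prodℕ-cong (f≡g ∘ suc))

  prodℕ-1 : ∀ p → prodℕ {p} (λ _ → 1) ≡ 1
  prodℕ-1 zero    = refl
  prodℕ-1 (suc p) = trans (+-identityʳ _) (prodℕ-1 p)

  prodℕ-!-increment : (t : Fin p) (a b : Fin p → ℕ) → (∀ l → a l ≡ 𝟙 (t ≟ l) + b l) →
                      prodℕ (λ l → a l !) ≡ a t * prodℕ (λ l → b l !)
  prodℕ-!-increment zero a b a≡ = begin
    a zero ! * prodℕ (λ l → a (suc l) !)
      ≡⟨ cong₂ _*_ (cong _! (a≡ zero)) (prodℕ-cong (cong _! ∘ a≡ ∘ suc)) ⟩
    suc (b zero) * b zero ! * prodℕ (λ l → b (suc l) !)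
      ≡⟨ *-assoc (suc (b zero)) (b zero !) _ ⟩
    suc (b zero) * (b zero ! * prodℕ (λ l → b (suc l) !))
      ≡⟨ cong (_* _) (a≡ zero) ⟨
    a zero * prodℕ (λ l → b l !) ∎
    where open ≡-Reasoning
  prodℕ-!-increment (suc t) a b a≡ = begin
    a zero ! * prodℕ (λ l → a (suc l) !)
      ≡⟨ cong₂ _*_ (cong _! (a≡ zero)) (prodℕ-!-increment t (a ∘ suc) (b ∘ suc) (a≡ ∘ suc)) ⟩
    b zero ! * (a (suc t) * prodℕ (λ l → b (suc l) !))
      ≡⟨ swap (b zero !) (a (suc t)) _ ⟩
    a (suc t) * prodℕ (λ l → b l !) ∎
    where
    open ≡-Reasoning
    swap : ∀ x y z → x * (y * z) ≡ y * (x * z)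
    swap = solve-∀

  ⟦_⟧ : {P : Pred (Fin n) ℓ} → Decidable P → Subset n
  ⟦ P? ⟧ = tabulate (does ∘ P?)

  module _ {P : Pred (Fin n) ℓ} (P? : Decidable P) {x : Fin n} where

    ∈⟦⟧⁺ : P x → x ∈ ⟦ P? ⟧
    ∈⟦⟧⁺ px = Vec.lookup⇒[]= x _ (trans (Vec.lookup∘tabulate _ x) (dec-true (P? x) px))

    ∈⟦⟧⁻ : x ∈ ⟦ P? ⟧ → P x
    ∈⟦⟧⁻ x∈ with P? x | trans (sym (Vec.lookup∘tabulate (does ∘ P?) x)) (Vec.[]=⇒lookup x∈)
    ... | yes px | _  = px
    ... | no  _  | ()

  ∣p∣≡∑𝟙 : (p : Subset n) → ∣ p ∣ ≡ ∑[ x < n ] 𝟙 (x ∈? p)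
  ∣p∣≡∑𝟙 []            = refl
  ∣p∣≡∑𝟙 (inside  ∷ p) = cong suc (∣p∣≡∑𝟙 p)
  ∣p∣≡∑𝟙 (outside ∷ p) = ∣p∣≡∑𝟙 p

  Empty⇒∣p∣≡0 : {p : Subset n} → Empty p → ∣ p ∣ ≡ 0
  Empty⇒∣p∣≡0 {n} p-empty = trans (cong ∣_∣ (Empty-unique p-empty)) (∣⊥∣≡0 n)

  p≢⊥⇒Nonempty : (p : Subset n) → p ≢ ⊥ → Nonempty p
  p≢⊥⇒Nonempty p p≢⊥ with nonempty? p
  ... | yes p-nonempty = p-nonempty
  ... | no  p-empty    = contradiction (Empty-unique p-empty) p≢⊥

  x∈p─q⇒x∉q : ∀ {x} (p q : Subset n) → x ∈ p ─ q → x ∉ q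
  x∈p─q⇒x∉q (inside ∷ p) (outside ∷ q) here       ()
  x∈p─q⇒x∉q (_      ∷ p) (outside ∷ q) (there x∈) (there x∈q) = x∈p─q⇒x∉q p q x∈ x∈q
  x∈p─q⇒x∉q (_      ∷ p) (inside  ∷ q) (there x∈) (there x∈q) = x∈p─q⇒x∉q p q x∈ x∈q

  x∈p-y⁻ : ∀ {x y} (p : Subset n) → x ∈ p - y → x ∈ p × x ≢ y
  x∈p-y⁻ {y = y} p x∈ = p─q⊆p p ⁅ y ⁆ x∈ , λ { refl → x∈p─q⇒x∉q p ⁅ y ⁆ x∈ (x∈⁅x⁆ y) }

  x∈p⇒∣p∣≡1+∣p-x∣ : ∀ {x} (p : Subset n) → x ∈ p → ∣ p ∣ ≡ suc ∣ p - x ∣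
  x∈p⇒∣p∣≡1+∣p-x∣ (inside  ∷ p) here        = cong (suc ∘ ∣_∣) (sym (p─⊥≡p p))
  x∈p⇒∣p∣≡1+∣p-x∣ (inside  ∷ p) (there x∈p) = cong suc (x∈p⇒∣p∣≡1+∣p-x∣ p x∈p)
  x∈p⇒∣p∣≡1+∣p-x∣ (outside ∷ p) (there x∈p) = x∈p⇒∣p∣≡1+∣p-x∣ p x∈p

  x∈p∧∣p∣≡1+k⇒∣p-x∣≡k : ∀ {x k} (p : Subset n) → x ∈ p → ∣ p ∣ ≡ suc k → ∣ p - x ∣ ≡ k
  x∈p∧∣p∣≡1+k⇒∣p-x∣≡k p x∈p ∣p∣≡1+k = suc-injective (trans (sym (x∈p⇒∣p∣≡1+∣p-x∣ p x∈p)) ∣p∣≡1+k)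

  ∣p∣≡0⇒x∉p : ∀ {x} (p : Subset n) → ∣ p ∣ ≡ 0 → x ∉ p
  ∣p∣≡0⇒x∉p p ∣p∣≡0 x∈p with () ← trans (sym ∣p∣≡0) (x∈p⇒∣p∣≡1+∣p-x∣ p x∈p)

  ∣p∣≡0⇒p≡⊥ : (p : Subset n) → ∣ p ∣ ≡ 0 → p ≡ ⊥
  ∣p∣≡0⇒p≡⊥ p ∣p∣≡0 = Empty-unique λ (x , x∈p) → ∣p∣≡0⇒x∉p p ∣p∣≡0 x∈p

  ∣p∣≡∣p∩q∣+∣p─q∣ : (p q : Subset n) → ∣ p ∣ ≡ ∣ p ∩ q ∣ + ∣ p ─ q ∣
  ∣p∣≡∣p∩q∣+∣p─q∣ []            []            = refl
  ∣p∣≡∣p∩q∣+∣p─q∣ (outside ∷ p) (inside  ∷ q) = ∣p∣≡∣p∩q∣+∣p─q∣ p q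
  ∣p∣≡∣p∩q∣+∣p─q∣ (outside ∷ p) (outside ∷ q) = ∣p∣≡∣p∩q∣+∣p─q∣ p q
  ∣p∣≡∣p∩q∣+∣p─q∣ (inside  ∷ p) (inside  ∷ q) = cong suc (∣p∣≡∣p∩q∣+∣p─q∣ p q)
  ∣p∣≡∣p∩q∣+∣p─q∣ (inside  ∷ p) (outside ∷ q) =
    trans (cong suc (∣p∣≡∣p∩q∣+∣p─q∣ p q)) (sym (+-suc _ _))

  x∉p⇒∣p∪⁅x⁆∣≡1+∣p∣ : ∀ {x} (p : Subset n) → x ∉ p → ∣ p ∪ ⁅ x ⁆ ∣ ≡ suc ∣ p ∣
  x∉p⇒∣p∪⁅x⁆∣≡1+∣p∣ {x = zero}  (inside  ∷ p) x∉p = contradiction here x∉p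
  x∉p⇒∣p∪⁅x⁆∣≡1+∣p∣ {x = zero}  (outside ∷ p) _   = cong (suc ∘ ∣_∣) (∪-identityʳ p)
  x∉p⇒∣p∪⁅x⁆∣≡1+∣p∣ {x = suc x} (inside  ∷ p) x∉p = cong suc (x∉p⇒∣p∪⁅x⁆∣≡1+∣p∣ p (x∉p ∘ there))
  x∉p⇒∣p∪⁅x⁆∣≡1+∣p∣ {x = suc x} (outside ∷ p) x∉p = x∉p⇒∣p∪⁅x⁆∣≡1+∣p∣ p (x∉p ∘ there)

  subsingleton⇒∣p∣≤1 : (p : Subset n) → (∀ {x y} → x ∈ p → y ∈ p → x ≡ y) → ∣ p ∣ ≤ 1
  subsingleton⇒∣p∣≤1 p unique with nonempty? p
  ... | no  p-empty     = ≤-trans (≤-reflexive (Empty⇒∣p∣≡0 p-empty)) z≤n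
  ... | yes (x , x∈p) = ≤-trans (p⊆q⇒∣p∣≤∣q∣ (λ y∈p → subst (_∈ ⁅ x ⁆) (unique x∈p y∈p) (x∈⁅x⁆ x)))
                                (≤-reflexive (∣⁅x⁆∣≡1 x))

  ∈unionAll⁻ : ∀ {x} (B : Fin p → Subset n) → x ∈ unionAll B → ∃ λ l → x ∈ B l
  ∈unionAll⁻ {zero}  B x∈ = contradiction x∈ ∉⊥
  ∈unionAll⁻ {suc p} B x∈ with x∈p∪q⁻ (B zero) _ x∈
  ... | inj₁ x∈B₀   = zero , x∈B₀
  ... | inj₂ x∈rest = let l , x∈Bl = ∈unionAll⁻ (B ∘ suc) x∈rest in suc l , x∈Bl

  ∈unionExcept⁻ : ∀ {x} (k : Fin p) (B : Fin p → Subset n) → x ∈ unionExcept k B → ∃ λ l → l ≢ k × x ∈ B l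
  ∈unionExcept⁻ k B x∈ with ∈unionAll⁻ _ x∈
  ... | l , x∈l with l ≟ k
  ...   | yes _   = contradiction x∈l ∉⊥
  ...   | no  l≢k = l , l≢k , x∈l

  Collision : {X : Set ℓ} → (Fin m → X) → Subset m → Set ℓ
  Collision f I = ∃₂ λ i j → i ∈ I × j ∈ I × i ≢ j × f i ≡ f j

  module _ {X : Set ℓ} (_≟ˣ_ : DecidableEquality X) (f : Fin m → X) where

    fiber : Fin m → Subset m
    fiber j = ⟦ (λ i → f i ≟ˣ f j) ⟧

    collision-without : ∀ I j → (∀ {i} → i ∈ I → f i ≢ f j) → Collision f (I ∪ ⁅ j ⁆) → Collision f I
    collision-without I j apart (i , i′ , i∈ , i′∈ , i≢i′ , fi≡fi′)
      with x∈p∪q⁻ I ⁅ j ⁆ i∈ | x∈p∪q⁻ I ⁅ j ⁆ i′∈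
    ... | inj₁ i∈I | inj₁ i′∈I = i , i′ , i∈I , i′∈I , i≢i′ , fi≡fi′
    ... | inj₁ i∈I | inj₂ i′∈j =
      contradiction (subst (λ k → f i ≡ f k) (x∈⁅y⁆⇒x≡y j i′∈j) fi≡fi′) (apart i∈I)
    ... | inj₂ i∈j | inj₁ i′∈I =
      contradiction (subst (λ k → f i′ ≡ f k) (x∈⁅y⁆⇒x≡y j i∈j) (sym fi≡fi′)) (apart i′∈I)
    ... | inj₂ i∈j | inj₂ i′∈j =
      contradiction (trans (x∈⁅y⁆⇒x≡y j i∈j) (sym (x∈⁅y⁆⇒x≡y j i′∈j))) i≢i′

    pigeonhole : ∀ r B J → (∀ {j} → j ∈ J → ∣ J ∩ fiber j ∣ ≤ B) →
                 (∀ I → I ⊆ J → ∣ I ∣ ≡ suc r → Collision f I) → ∣ J ∣ ≤ r * B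
    pigeonhole r B J small collide with nonempty? J
    ... | no J-empty = ≤-trans (≤-reflexive (Empty⇒∣p∣≡0 J-empty)) z≤n
    pigeonhole zero B J small collide | yes (j , j∈J)
      with collide ⁅ j ⁆ (λ i∈ → subst (_∈ J) (sym (x∈⁅y⁆⇒x≡y j i∈)) j∈J) (∣⁅x⁆∣≡1 j)
    ... | i , i′ , i∈ , i′∈ , i≢i′ , _ =
      contradiction (trans (x∈⁅y⁆⇒x≡y j i∈) (sym (x∈⁅y⁆⇒x≡y j i′∈))) i≢i′
    pigeonhole (suc r) B J small collide | yes (j , j∈J) = begin
      ∣ J ∣                    ≡⟨ ∣p∣≡∣p∩q∣+∣p─q∣ J (fiber j) ⟩
      ∣ J ∩ fiber j ∣ + ∣ J′ ∣  ≤⟨ +-mono-≤ (small j∈J) (pigeonhole r B J′ small′ collide′) ⟩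
      B + r * B                ∎
      where
      open ≤-Reasoning
      J′ = J ─ fiber j
      J′⊆J : J′ ⊆ J
      J′⊆J = p─q⊆p J (fiber j)
      small′ : ∀ {i} → i ∈ J′ → ∣ J′ ∩ fiber i ∣ ≤ B
      small′ i∈J′ = ≤-trans (p⊆q⇒∣p∣≤∣q∣ λ x∈ → let x∈J′ , x∈fiber = x∈p∩q⁻ J′ _ x∈
                                                in  x∈p∩q⁺ (J′⊆J x∈J′ , x∈fiber))
                            (small (J′⊆J i∈J′))
      apart : ∀ {i} → i ∈ J′ → f i ≢ f j
      apart i∈J′ fi≡fj = x∈p─q⇒x∉q J (fiber j) i∈J′ (∈⟦⟧⁺ (λ i → f i ≟ˣ f j) fi≡fj)
      collide′ : ∀ I → I ⊆ J′ → ∣ I ∣ ≡ suc r → Collision f I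
      collide′ I I⊆J′ ∣I∣≡1+r = collision-without I j (apart ∘ I⊆J′) (collide (I ∪ ⁅ j ⁆) I∪j⊆J
        (trans (x∉p⇒∣p∪⁅x⁆∣≡1+∣p∣ I (λ j∈I → apart (I⊆J′ j∈I) refl)) (cong suc ∣I∣≡1+r)))
        where
        I∪j⊆J : I ∪ ⁅ j ⁆ ⊆ J
        I∪j⊆J i∈ with x∈p∪q⁻ I ⁅ j ⁆ i∈
        ... | inj₁ i∈I = J′⊆J (I⊆J′ i∈I)
        ... | inj₂ i∈j = subst (_∈ J) (sym (x∈⁅y⁆⇒x≡y j i∈j)) j∈J

  AgreeBelow : {X : Set ℓ} → (Fin m → Fin p → X) → Fin p → Subset m → Set ℓ
  AgreeBelow F k I = ∀ {i j} → i ∈ I → j ∈ I → ∀ l → l Fin.< k → F i l ≡ F j l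

  product-pigeonhole : {X : Set ℓ} → DecidableEquality X → ∀ r (F : Fin m → Fin p → X) J →
    (∀ {i j} → i ∈ J → j ∈ J → (∀ k → F i k ≡ F j k) → i ≡ j) →
    (∀ k I → I ⊆ J → ∣ I ∣ ≡ suc r → AgreeBelow F k I → Collision (λ i → F i k) I) →
    ∣ J ∣ ≤ r ^ p
  product-pigeonhole {p = zero} _≟ˣ_ r F J injective collide =
    subsingleton⇒∣p∣≤1 J (λ i∈J j∈J → injective i∈J j∈J λ ())
  product-pigeonhole {p = suc p} _≟ˣ_ r F J injective collide =
    pigeonhole _≟ˣ_ (λ i → F i zero) r (r ^ p) J small (λ I I⊆J ∣I∣ → collide zero I I⊆J ∣I∣ λ _ _ _ ())
    where
    small : ∀ {j} → j ∈ J → ∣ J ∩ fiber _≟ˣ_ (λ i → F i zero) j ∣ ≤ r ^ p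
    small {j} _ = product-pigeonhole _≟ˣ_ r (λ i k → F i (suc k)) C injective′ collide′
      where
      C = J ∩ fiber _≟ˣ_ (λ i → F i zero) j
      in-J : ∀ {i} → i ∈ C → i ∈ J
      in-J i∈C = proj₁ (x∈p∩q⁻ J _ i∈C)
      first : ∀ {i} → i ∈ C → F i zero ≡ F j zero
      first i∈C = ∈⟦⟧⁻ (λ i → F i zero ≟ˣ F j zero) (proj₂ (x∈p∩q⁻ J _ i∈C))
      injective′ : ∀ {i i′} → i ∈ C → i′ ∈ C → (∀ k → F i (suc k) ≡ F i′ (suc k)) → i ≡ i′
      injective′ i∈C i′∈C rest = injective (in-J i∈C) (in-J i′∈C) λ
        { zero    → trans (first i∈C) (sym (first i′∈C))
        ; (suc k) → rest k }
      collide′ : ∀ k I → I ⊆ C → ∣ I ∣ ≡ suc r → AgreeBelow (λ i k → F i (suc k)) k I →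
                 Collision (λ i → F i (suc k)) I
      collide′ k I I⊆C ∣I∣ agree = collide (suc k) I (in-J ∘ I⊆C) ∣I∣ λ
        { i∈I i′∈I zero    _           → trans (first (I⊆C i∈I)) (sym (first (I⊆C i′∈I)))
        ; i∈I i′∈I (suc l) (s≤s l<k) → agree i∈I i′∈I l l<k }

  -- The orderings of R, when ∣ R ∣ ≡ k, in which each element is admissible among those not yet listed.
  arrangements : {Adm : Subset n → Pred (Fin n) ℓ} → (∀ R → Decidable (Adm R)) → ℕ → Subset n → ℕ
  arrangements     adm? zero    R = 1
  arrangements {n} adm? (suc k) R = ∑[ x < n ] (𝟙 (adm? R x) * arrangements adm? k (R - x))

  admitting : {Adm : Fin m → Subset n → Pred (Fin n) ℓ} → (∀ j R → Decidable (Adm j R)) →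
              Subset m → Subset n → Fin n → Subset m
  admitting adm? J R x = J ∩ ⟦ (λ j → adm? j R x) ⟧

  module _ {Adm : Fin m → Subset n → Pred (Fin n) ℓ} (adm? : ∀ j R → Decidable (Adm j R))
           (adm⇒∈ : ∀ {j R x} → Adm j R x → x ∈ R) where

    𝟙-admitting : ∀ J R x j → 𝟙 (j ∈? admitting adm? J R x) ≡ 𝟙 (j ∈? J) * 𝟙 (adm? j R x)
    𝟙-admitting J R x j =
      trans (𝟙-⇔ ∈admitting⇔ (j ∈? admitting adm? J R x) (j ∈? J ×-dec adm? j R x))
            (𝟙-× (j ∈? J) (adm? j R x))
      where
      ∈admitting⇔ : j ∈ admitting adm? J R x ⇔ (j ∈ J × Adm j R x)
      ∈admitting⇔ = mk⇔ (λ j∈ → let j∈J , j∈A = x∈p∩q⁻ J _ j∈ in j∈J , ∈⟦⟧⁻ (λ j → adm? j R x) j∈A)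
                        (λ (j∈J , adm) → x∈p∩q⁺ (j∈J , ∈⟦⟧⁺ (λ j → adm? j R x) adm))

    -- Splitting an arrangement at its first element x leaves an arrangement of R - x, and the members
    -- of J for which it is counted are then those of admitting adm? J R x.
    double-counting : (Good : Subset n → Subset m → Set ℓ′) {B : ℕ} →
      (∀ {R J} x → Good R J → Good (R - x) (admitting adm? J R x)) →
      (∀ {J} → Good ⊥ J → ∣ J ∣ ≤ B) →
      ∀ k R J → ∣ R ∣ ≡ k → Good R J → ∑[ j < m ] (𝟙 (j ∈? J) * arrangements (adm? j) k R) ≤ k ! * B
    double-counting Good {B} hereditary base zero R J ∣R∣≡0 good = begin
      ∑[ j < m ] (𝟙 (j ∈? J) * 1)  ≡⟨ sum-cong-≗ {m} (λ j → *-identityʳ (𝟙 (j ∈? J))) ⟩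
      ∑[ j < m ] 𝟙 (j ∈? J)        ≡⟨ ∣p∣≡∑𝟙 J ⟨
      ∣ J ∣                        ≤⟨ base (subst (λ R → Good R J) (∣p∣≡0⇒p≡⊥ R ∣R∣≡0) good) ⟩
      B                            ≡⟨ +-identityʳ B ⟨
      1 * B                        ∎
      where open ≤-Reasoning
    double-counting Good {B} hereditary base (suc k) R J ∣R∣≡ good = begin
      ∑[ j < m ] (𝟙 (j ∈? J) * ∑[ x < n ] (𝟙 (adm? j R x) * T j x))
        ≡⟨ sum-cong-≗ {m} (λ j → *-distribˡ-sum {n} (𝟙 (j ∈? J)) _) ⟩
      ∑[ j < m ] ∑[ x < n ] (𝟙 (j ∈? J) * (𝟙 (adm? j R x) * T j x))
        ≡⟨ ∑-comm {m} {n} _ ⟩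
      ∑[ x < n ] ∑[ j < m ] (𝟙 (j ∈? J) * (𝟙 (adm? j R x) * T j x))
        ≤⟨ ∑-mono-≤ {n} bound ⟩
      ∑[ x < n ] (𝟙 (x ∈? R) * (k ! * B))
        ≡⟨ *-distribʳ-sum {n} (k ! * B) _ ⟨
      ∑[ x < n ] 𝟙 (x ∈? R) * (k ! * B)
        ≡⟨ cong (_* (k ! * B)) (trans (sym ∣R∣≡) (∣p∣≡∑𝟙 R)) ⟨
      suc k * (k ! * B)
        ≡⟨ *-assoc (suc k) (k !) B ⟨
      suc k ! * B ∎
      where
      open ≤-Reasoning
      T : Fin m → Fin n → ℕ
      T j x = arrangements (adm? j) k (R - x)
      bound : ∀ x → ∑[ j < m ] (𝟙 (j ∈? J) * (𝟙 (adm? j R x) * T j x)) ≤ 𝟙 (x ∈? R) * (k ! * B)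
      bound x with x ∈? R
      ... | no x∉R = ≤-trans (≤-reflexive (∑-zero {m} λ j → trans
              (cong (λ c → 𝟙 (j ∈? J) * (c * T j x)) (𝟙-no (adm? j R x) (x∉R ∘ adm⇒∈)))
              (*-zeroʳ (𝟙 (j ∈? J)))))
              z≤n
      ... | yes x∈R = begin
        ∑[ j < m ] (𝟙 (j ∈? J) * (𝟙 (adm? j R x) * T j x))
          ≡⟨ sum-cong-≗ {m} (λ j → trans (cong (_* T j x) (𝟙-admitting J R x j))
                                         (*-assoc (𝟙 (j ∈? J)) _ _)) ⟨
        ∑[ j < m ] (𝟙 (j ∈? admitting adm? J R x) * T j x)
          ≤⟨ double-counting Good hereditary base k (R - x) (admitting adm? J R x)
               (x∈p∧∣p∣≡1+k⇒∣p-x∣≡k R x∈R ∣R∣≡) (hereditary x good) ⟩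
        k ! * B
          ≡⟨ +-identityʳ (k ! * B) ⟨
        1 * (k ! * B) ∎

  greatest : {P : Pred (Fin p) ℓ} → Decidable P → (∀ l → ¬ P l) ⊎ ∃ λ t → P t × ∀ {l} → P l → l Fin.≤ t
  greatest {p = zero}  P? = inj₁ λ ()
  greatest {p = suc p} P? with greatest (P? ∘ suc)
  ... | inj₂ (t , Pt , below) = inj₂ (suc t , Pt , λ { {zero} _ → z≤n ; {suc l} Pl → s≤s (below Pl) })
  ... | inj₁ none with P? zero
  ...   | yes P₀  = inj₂ (zero , P₀ , λ { {zero} _ → z≤n ; {suc l} Pl → contradiction Pl (none l) })
  ...   | no  ¬P₀ = inj₁ λ { zero → ¬P₀ ; (suc l) → none l }

  data _⊏_ {p : ℕ} : Maybe (Fin p) → Maybe (Fin p) → Set where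
    just⊏just : ∀ {l l′} → l Fin.< l′ → just l ⊏ just l′

  _⊏?_ : ∀ {p} (u v : Maybe (Fin p)) → Dec (u ⊏ v)
  just l  ⊏? just l′ = map′ just⊏just (λ { (just⊏just l<l′) → l<l′ }) (l <? l′)
  just _  ⊏? nothing = no λ ()
  nothing ⊏? _       = no λ ()

  infix 4 _≟ᴹ_
  _≟ᴹ_ : DecidableEquality (Maybe (Fin p))
  _≟ᴹ_ = Maybe.≡-dec _≟_

  -- level x ≡ just l says that x lies in part l, and level x ≡ nothing that it lies in no part.
  module Levels (level : Fin n → Maybe (Fin p)) where

    Admissible : Subset n → Pred (Fin n) 0ℓ
    Admissible R x = x ∈ R × (∀ z → z ∈ R → ¬ level x ⊏ level z)

    admissible? : ∀ R → Decidable (Admissible R)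
    admissible? R x = x ∈? R ×-dec all? (λ z → z ∈? R →-dec ¬? (level x ⊏? level z))

    count-at : Subset n → Maybe (Fin p) → ℕ
    count-at R v = ∑[ x < n ] 𝟙 (x ∈? R ×-dec level x ≟ᴹ v)

    levelled : Subset n → ℕ
    levelled R = ∑[ l < p ] count-at R (just l)

    ∏size! : Subset n → ℕ
    ∏size! R = prodℕ (λ l → count-at R (just l) !)

    ∣R∣≡unlevelled+levelled : ∀ R → ∣ R ∣ ≡ count-at R nothing + levelled R
    ∣R∣≡unlevelled+levelled R = begin
      ∣ R ∣
        ≡⟨ ∣p∣≡∑𝟙 R ⟩
      ∑[ x < n ] 𝟙 (x ∈? R)
        ≡⟨ sum-cong-≗ split ⟩
      ∑[ x < n ] (𝟙 (x ∈? R ×-dec level x ≟ᴹ nothing) + ∑[ l < p ] 𝟙 (x ∈? R ×-dec level x ≟ᴹ just l))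
        ≡⟨ ∑-distrib-+ {n} _ _ ⟩
      count-at R nothing + ∑[ x < n ] ∑[ l < p ] 𝟙 (x ∈? R ×-dec level x ≟ᴹ just l)
        ≡⟨ cong (_+_ (count-at R nothing)) (∑-comm {n} {p} _) ⟩
      count-at R nothing + levelled R ∎
      where
      open ≡-Reasoning
      split : ∀ x → 𝟙 (x ∈? R) ≡
                    𝟙 (x ∈? R ×-dec level x ≟ᴹ nothing) + ∑[ l < p ] 𝟙 (x ∈? R ×-dec level x ≟ᴹ just l)
      split x with x ∈? R
      ... | no  _ = sym (∑-zero {p} λ _ → refl)
      ... | yes _ with level x
      ...   | nothing = cong suc (sym (∑-zero {p} λ _ → refl))
      ...   | just t  = sym (∑-𝟙≟ t)

    count-at-remove : ∀ {R x} v → x ∈ R → count-at R v ≡ 𝟙 (level x ≟ᴹ v) + count-at (R - x) v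
    count-at-remove {R} {x} v x∈R = begin
      count-at R v
        ≡⟨ sum-cong-≗ split ⟩
      ∑[ z < n ] (𝟙 (x ≟ z) * 𝟙 (level z ≟ᴹ v) + 𝟙 (z ∈? R - x ×-dec level z ≟ᴹ v))
        ≡⟨ ∑-distrib-+ {n} _ _ ⟩
      ∑[ z < n ] (𝟙 (x ≟ z) * 𝟙 (level z ≟ᴹ v)) + count-at (R - x) v
        ≡⟨ cong (_+ count-at (R - x) v) (∑-𝟙≟* x _) ⟩
      𝟙 (level x ≟ᴹ v) + count-at (R - x) v ∎
      where
      open ≡-Reasoning
      split : ∀ z → 𝟙 (z ∈? R ×-dec level z ≟ᴹ v) ≡
                    𝟙 (x ≟ z) * 𝟙 (level z ≟ᴹ v) + 𝟙 (z ∈? R - x ×-dec level z ≟ᴹ v)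
      split z with x ≟ z | z ∈? R | z ∈? R - x
      ... | yes refl | yes _   | no _    = sym (trans (+-identityʳ _) (+-identityʳ _))
      ... | yes refl | _       | yes x∈  = contradiction refl (proj₂ (x∈p-y⁻ R x∈))
      ... | yes refl | no x∉R  | _       = contradiction x∈R x∉R
      ... | no _     | yes _   | yes _   = refl
      ... | no _     | no z∉R  | yes z∈  = contradiction (proj₁ (x∈p-y⁻ R z∈)) z∉R
      ... | no x≢z   | yes z∈R | no z∉   = contradiction (x∈p∧x≢y⇒x∈p-y z∈R (x≢z ∘ sym)) z∉
      ... | no _     | no _    | no _    = refl

    count-at-remove-unlevelled : ∀ {R x} → x ∈ R → level x ≡ nothing →
                        ∀ l → count-at (R - x) (just l) ≡ count-at R (just l)
    count-at-remove-unlevelled {R} {x} x∈R lx≡ l =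
      sym (subst (λ u → count-at R (just l) ≡ 𝟙 (u ≟ᴹ just l) + count-at (R - x) (just l)) lx≡
                 (count-at-remove (just l) x∈R))

    count-at-remove-levelled : ∀ {R x t} → x ∈ R → level x ≡ just t →
                      ∀ l → count-at R (just l) ≡ 𝟙 (t ≟ l) + count-at (R - x) (just l)
    count-at-remove-levelled {R} {x} x∈R lx≡ l =
      subst (λ u → count-at R (just l) ≡ 𝟙 (u ≟ᴹ just l) + count-at (R - x) (just l)) lx≡
            (count-at-remove (just l) x∈R)

    levelled-remove : ∀ {R x t} → x ∈ R → level x ≡ just t → levelled R ≡ suc (levelled (R - x))
    levelled-remove {R} {x} {t} x∈R lx≡ = begin
      levelled R                                          ≡⟨ sum-cong-≗ {p} (count-at-remove-levelled x∈R lx≡) ⟩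
      ∑[ l < p ] (𝟙 (t ≟ l) + count-at (R - x) (just l))  ≡⟨ ∑-distrib-+ {p} _ _ ⟩
      ∑[ l < p ] 𝟙 (t ≟ l) + levelled (R - x)             ≡⟨ cong (_+ levelled (R - x)) (∑-𝟙≟ t) ⟩
      suc (levelled (R - x))                              ∎
      where open ≡-Reasoning

    ∏size!-remove : ∀ {R w t} → w ∈ R → level w ≡ just t → ∏size! R ≡ count-at R (just t) * ∏size! (R - w)
    ∏size!-remove {R} {w} w∈R lw≡ =
      prodℕ-!-increment _ (count-at R ∘ just) (count-at (R - w) ∘ just) (count-at-remove-levelled w∈R lw≡)

    ∏size!-remove-same-level : ∀ {R x w} → x ∈ R → w ∈ R → level x ≡ level w → ∏size! (R - x) ≡ ∏size! (R - w)
    ∏size!-remove-same-level {R} {x} {w} x∈R w∈R lx≡lw =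
      prodℕ-cong λ l → cong _! (+-cancelˡ-≡ (𝟙 (level x ≟ᴹ just l)) _ _ (begin
        𝟙 (level x ≟ᴹ just l) + count-at (R - x) (just l)  ≡⟨ count-at-remove (just l) x∈R ⟨
        count-at R (just l)                                ≡⟨ count-at-remove (just l) w∈R ⟩
        𝟙 (level w ≟ᴹ just l) + count-at (R - w) (just l)
          ≡⟨ cong (λ u → 𝟙 (u ≟ᴹ just l) + count-at (R - w) (just l)) lx≡lw ⟨
        𝟙 (level x ≟ᴹ just l) + count-at (R - w) (just l)  ∎))
      where open ≡-Reasoning

    unlevelled-admissible : ∀ {R x} → x ∈ R → level x ≡ nothing → Admissible R x
    unlevelled-admissible {x = x} x∈R lx≡ = x∈R , λ z _ → subst (λ u → ¬ u ⊏ level z) (sym lx≡) λ ()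

    TopLevel : Subset n → Fin p → Set
    TopLevel R t = (∃ λ w → w ∈ R × level w ≡ just t) × (∀ {z l} → z ∈ R → level z ≡ just l → l Fin.≤ t)

    top-level : ∀ R → (∀ {z} → z ∈ R → level z ≡ nothing) ⊎ ∃ (TopLevel R)
    top-level R with greatest (λ t → any? (λ z → z ∈? R ×-dec level z ≟ᴹ just t))
    ... | inj₂ (t , occupied , below) = inj₂ (t , occupied , λ z∈R lz≡ → below (_ , z∈R , lz≡))
    ... | inj₁ empty = inj₁ unlevelled
      where
      unlevelled : ∀ {z} → z ∈ R → level z ≡ nothing
      unlevelled {z} z∈R with level z in lz≡
      ... | nothing = refl
      ... | just l  = contradiction (z , z∈R , lz≡) (empty l)

    admissible⇔unlevelled : ∀ {R x} → (∀ {z} → z ∈ R → level z ≡ nothing) →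
                            Admissible R x ⇔ (x ∈ R × level x ≡ nothing)
    admissible⇔unlevelled unlevelled =
      mk⇔ (λ (x∈R , _) → x∈R , unlevelled x∈R) (λ (x∈R , lx≡) → unlevelled-admissible x∈R lx≡)

    admissible⇔unlevelled⊎top : ∀ {R x t} → TopLevel R t →
      Admissible R x ⇔ ((x ∈ R × level x ≡ nothing) ⊎ (x ∈ R × level x ≡ just t))
    admissible⇔unlevelled⊎top {R} {x} {t} ((w , w∈R , lw≡) , below) = mk⇔ to from
      where
      to : Admissible R x → (x ∈ R × level x ≡ nothing) ⊎ (x ∈ R × level x ≡ just t)
      to (x∈R , maximal) with level x in lx≡
      ... | nothing = inj₁ (x∈R , refl)
      ... | just l with l ≟ t
      ...   | yes refl = inj₂ (x∈R , refl)
      ...   | no  l≢t  = contradiction (subst (just l ⊏_) (sym lw≡) (just⊏just (≤∧≢⇒< (below x∈R lx≡) l≢t)))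
                                       (maximal w w∈R)
      top-maximal : ∀ z → z ∈ R → ¬ just t ⊏ level z
      top-maximal z z∈R with level z in lz≡
      ... | just l = λ { (just⊏just t<l) → <⇒≱ t<l (below z∈R lz≡) }
      from : (x ∈ R × level x ≡ nothing) ⊎ (x ∈ R × level x ≡ just t) → Admissible R x
      from (inj₁ (x∈R , lx≡)) = unlevelled-admissible x∈R lx≡
      from (inj₂ (x∈R , lx≡)) = x∈R , λ z z∈R → subst (λ u → ¬ u ⊏ level z) (sym lx≡) (top-maximal z z∈R)

    ArrangementCount : ℕ → Set
    ArrangementCount k = ∀ R → ∣ R ∣ ≡ k → arrangements admissible? k R * levelled R ! ≡ k ! * ∏size! R

    first-unlevelled : ∀ {k R x} → ArrangementCount k → ∣ R ∣ ≡ suc k → x ∈ R → level x ≡ nothing →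
                       arrangements admissible? k (R - x) * levelled R ! ≡ k ! * ∏size! R
    first-unlevelled {k} {R} {x} count ∣R∣≡ x∈R lx≡ = begin
      N * levelled R !        ≡⟨ cong (λ s → N * s !) (sum-cong-≗ {p} same) ⟨
      N * levelled (R - x) !  ≡⟨ count (R - x) (x∈p∧∣p∣≡1+k⇒∣p-x∣≡k R x∈R ∣R∣≡) ⟩
      k ! * ∏size! (R - x)    ≡⟨ cong (k ! *_) (prodℕ-cong (cong _! ∘ same)) ⟩
      k ! * ∏size! R          ∎
      where
      open ≡-Reasoning
      N    = arrangements admissible? k (R - x)
      same = count-at-remove-unlevelled x∈R lx≡

    first-levelled : ∀ {k R x t} → ArrangementCount k → ∣ R ∣ ≡ suc k → x ∈ R → level x ≡ just t →
                     arrangements admissible? k (R - x) * levelled R ! ≡ levelled R * (k ! * ∏size! (R - x))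
    first-levelled {k} {R} {x} count ∣R∣≡ x∈R lx≡ = begin
      N * levelled R !                     ≡⟨ cong (λ s → N * s !) s≡ ⟩
      N * (suc s′ * s′ !)                  ≡⟨ swap N (suc s′) (s′ !) ⟩
      suc s′ * (N * s′ !)                  ≡⟨ cong (suc s′ *_) (count (R - x) (x∈p∧∣p∣≡1+k⇒∣p-x∣≡k R x∈R ∣R∣≡)) ⟩
      suc s′ * (k ! * ∏size! (R - x))      ≡⟨ cong (_* (k ! * ∏size! (R - x))) s≡ ⟨
      levelled R * (k ! * ∏size! (R - x))  ∎
      where
      open ≡-Reasoning
      N  = arrangements admissible? k (R - x)
      s′ = levelled (R - x)
      s≡ = levelled-remove x∈R lx≡
      swap : ∀ x y z → x * (y * z) ≡ y * (x * z)
      swap = solve-∀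

    ∑-first-unlevelled : ∀ {k R} → ArrangementCount k → ∣ R ∣ ≡ suc k → (∀ {z} → z ∈ R → level z ≡ nothing) →
      ∑[ x < n ] (𝟙 (admissible? R x) * (arrangements admissible? k (R - x) * levelled R !)) ≡
      ∣ R ∣ * (k ! * ∏size! R)
    ∑-first-unlevelled {k} {R} count ∣R∣≡ unlevelled = begin
      ∑[ x < n ] (𝟙 (admissible? R x) * T x)                 ≡⟨ sum-cong-≗ {n} term ⟩
      ∑[ x < n ] (𝟙 (x ∈? R ×-dec level x ≟ᴹ nothing) * U)   ≡⟨ *-distribʳ-sum {n} U _ ⟨
      count-at R nothing * U                                 ≡⟨ cong (_* U) ∣R∣≡unlevelled ⟨
      ∣ R ∣ * U                                              ∎
      where
      open ≡-Reasoning
      T : Fin n → ℕ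
      T x = arrangements admissible? k (R - x) * levelled R !
      U = k ! * ∏size! R
      term : ∀ x → 𝟙 (admissible? R x) * T x ≡ 𝟙 (x ∈? R ×-dec level x ≟ᴹ nothing) * U
      term x = trans
        (cong (_* T x) (𝟙-⇔ (admissible⇔unlevelled unlevelled) (admissible? R x) bottom?))
        (𝟙*-cong bottom? λ (x∈R , lx≡) → first-unlevelled count ∣R∣≡ x∈R lx≡)
        where bottom? = x ∈? R ×-dec level x ≟ᴹ nothing
      no-levelled : levelled R ≡ 0
      no-levelled = ∑-zero {p} λ l → ∑-zero {n} λ z → 𝟙-no (z ∈? R ×-dec level z ≟ᴹ just l)
        λ (z∈R , lz≡) → contradiction (trans (sym (unlevelled z∈R)) lz≡) λ ()
      ∣R∣≡unlevelled : ∣ R ∣ ≡ count-at R nothing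
      ∣R∣≡unlevelled =
        trans (∣R∣≡unlevelled+levelled R) (trans (cong (_+_ (count-at R nothing)) no-levelled) (+-identityʳ _))

    ∑-first-top : ∀ {k R t} → ArrangementCount k → ∣ R ∣ ≡ suc k → TopLevel R t →
      ∑[ x < n ] (𝟙 (admissible? R x) * (arrangements admissible? k (R - x) * levelled R !)) ≡
      ∣ R ∣ * (k ! * ∏size! R)
    ∑-first-top {k} {R} {t} count ∣R∣≡ top@((w , w∈R , lw≡) , _) = begin
      ∑[ x < n ] (𝟙 (admissible? R x) * T x)
        ≡⟨ sum-cong-≗ {n} term ⟩
      ∑[ x < n ] (𝟙 (bottom? x) * U + 𝟙 (top? x) * V)
        ≡⟨ ∑-distrib-+ {n} _ _ ⟩
      ∑[ x < n ] (𝟙 (bottom? x) * U) + ∑[ x < n ] (𝟙 (top? x) * V)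
        ≡⟨ cong₂ _+_ (*-distribʳ-sum {n} U _) (*-distribʳ-sum {n} V _) ⟨
      u * U + a * V
        ≡⟨ cong (λ π → u * (K * π) + a * V) Π≡ ⟩
      u * (K * (a * W)) + a * (s * (K * W))
        ≡⟨ collect u a s K W ⟩
      (u + s) * (K * (a * W))
        ≡⟨ cong₂ (λ c π → c * (K * π)) (∣R∣≡unlevelled+levelled R) Π≡ ⟨
      ∣ R ∣ * U ∎
      where
      open ≡-Reasoning
      bottom? : ∀ x → Dec (x ∈ R × level x ≡ nothing)
      bottom? x = x ∈? R ×-dec level x ≟ᴹ nothing
      top? : ∀ x → Dec (x ∈ R × level x ≡ just t)
      top? x = x ∈? R ×-dec level x ≟ᴹ just t
      T : Fin n → ℕ
      T x = arrangements admissible? k (R - x) * levelled R !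
      K = k !
      W = ∏size! (R - w)
      U = K * ∏size! R
      V = levelled R * (K * W)
      u = count-at R nothing
      a = count-at R (just t)
      s = levelled R
      Π≡ : ∏size! R ≡ a * W
      Π≡ = ∏size!-remove w∈R lw≡
      collect : ∀ u a s K W → u * (K * (a * W)) + a * (s * (K * W)) ≡ (u + s) * (K * (a * W))
      collect = solve-∀
      exclusive : ∀ {x} → ¬ ((x ∈ R × level x ≡ nothing) × (x ∈ R × level x ≡ just t))
      exclusive ((_ , lx≡nothing) , (_ , lx≡just)) = contradiction (trans (sym lx≡nothing) lx≡just) λ ()
      term : ∀ x → 𝟙 (admissible? R x) * T x ≡ 𝟙 (bottom? x) * U + 𝟙 (top? x) * V
      term x = begin
        𝟙 (admissible? R x) * T x
          ≡⟨ cong (_* T x) (trans (𝟙-⇔ (admissible⇔unlevelled⊎top top) (admissible? R x) (bottom? x ⊎-dec top? x))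
                                  (𝟙-⊎ (bottom? x) (top? x) exclusive)) ⟩
        (𝟙 (bottom? x) + 𝟙 (top? x)) * T x
          ≡⟨ *-distribʳ-+ (T x) (𝟙 (bottom? x)) (𝟙 (top? x)) ⟩
        𝟙 (bottom? x) * T x + 𝟙 (top? x) * T x
          ≡⟨ cong₂ _+_ (𝟙*-cong (bottom? x) λ (x∈R , lx≡) → first-unlevelled count ∣R∣≡ x∈R lx≡)
                       (𝟙*-cong (top? x) λ (x∈R , lx≡) → trans (first-levelled count ∣R∣≡ x∈R lx≡)
                          (cong (λ π → s * (K * π)) (∏size!-remove-same-level x∈R w∈R (trans lx≡ (sym lw≡))))) ⟩
        𝟙 (bottom? x) * U + 𝟙 (top? x) * V ∎

    arrangements-count : ∀ k → ArrangementCount k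
    arrangements-count zero R ∣R∣≡0 = begin
      1 * levelled R !   ≡⟨ cong (λ s → 1 * s !) (∑-zero {p} no-parts) ⟩
      1                  ≡⟨ prodℕ-1 p ⟨
      prodℕ {p} (λ _ → 1) ≡⟨ prodℕ-cong (cong _! ∘ no-parts) ⟨
      ∏size! R           ≡⟨ *-identityˡ (∏size! R) ⟨
      1 * ∏size! R       ∎
      where
      open ≡-Reasoning
      no-parts : ∀ l → count-at R (just l) ≡ 0
      no-parts l = ∑-zero {n} λ x → 𝟙-no (x ∈? R ×-dec level x ≟ᴹ just l) (∣p∣≡0⇒x∉p R ∣R∣≡0 ∘ proj₁)
    arrangements-count (suc k) R ∣R∣≡ = begin
      arrangements admissible? (suc k) R * levelled R !
        ≡⟨ *-distribʳ-sum {n} (levelled R !) _ ⟩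
      ∑[ x < n ] (𝟙 (admissible? R x) * arrangements admissible? k (R - x) * levelled R !)
        ≡⟨ sum-cong-≗ {n} (λ x → *-assoc (𝟙 (admissible? R x)) _ _) ⟩
      ∑[ x < n ] (𝟙 (admissible? R x) * (arrangements admissible? k (R - x) * levelled R !))
        ≡⟨ ∑-first ⟩
      ∣ R ∣ * (k ! * ∏size! R)
        ≡⟨ cong (_* (k ! * ∏size! R)) ∣R∣≡ ⟩
      suc k * (k ! * ∏size! R)
        ≡⟨ *-assoc (suc k) (k !) _ ⟨
      suc k ! * ∏size! R ∎
      where
      open ≡-Reasoning
      ∑-first : ∑[ x < n ] (𝟙 (admissible? R x) * (arrangements admissible? k (R - x) * levelled R !)) ≡
                ∣ R ∣ * (k ! * ∏size! R)
      ∑-first with top-level R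
      ... | inj₁ unlevelled = ∑-first-unlevelled (arrangements-count k) ∣R∣≡ unlevelled
      ... | inj₂ (t , top)  = ∑-first-top (arrangements-count k) ∣R∣≡ top

  module _ (level : Fin m → Fin n → Maybe (Fin p)) where

    -- No ordering is compatible with both i and j: they force y before x and x before y respectively.
    Crossing : Fin m → Fin m → Fin n → Fin n → Set
    Crossing i j x y = level i x ⊏ level i y × level j y ⊏ level j x

    CrossingsWithin : Subset n → Subset m → Set
    CrossingsWithin R J = ∀ {i j x y} → i ∈ J → j ∈ J → Crossing i j x y → x ∈ R

    crossings-hereditary : ∀ {R J} x → CrossingsWithin R J →
                           CrossingsWithin (R - x) (admitting (λ j → Levels.admissible? (level j)) J R x)
    crossings-hereditary {R} {J} x within {i} {j} {x₀} {y₀} i∈ j∈ (x₀⊏y₀ , y₀⊏x₀) =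
      x∈p∧x≢y⇒x∈p-y (within i∈J j∈J (x₀⊏y₀ , y₀⊏x₀)) x₀≢x
      where
      i∈J = proj₁ (x∈p∩q⁻ J _ i∈)
      j∈J = proj₁ (x∈p∩q⁻ J _ j∈)
      x-admissible-for-i : Levels.Admissible (level i) R x
      x-admissible-for-i = ∈⟦⟧⁻ (λ i → Levels.admissible? (level i) R x) (proj₂ (x∈p∩q⁻ J _ i∈))
      x₀≢x : x₀ ≢ x
      x₀≢x refl = proj₂ x-admissible-for-i y₀ (within j∈J i∈J (y₀⊏x₀ , x₀⊏y₀)) x₀⊏y₀

  module _ {A : Fin p → Subset n} (wsc : IsWeakSetComposition A) where

    part-unique : ∀ {x k l} → x ∈ A k → x ∈ A l → k ≡ l
    part-unique {x} {k} {l} x∈Ak x∈Al with k ≟ l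
    ... | yes k≡l = k≡l
    ... | no  k≢l = contradiction (subst (x ∈_) (wsc k l k≢l) (x∈p∩q⁺ (x∈Ak , x∈Al))) ∉⊥

  levelOf : (Fin p → Subset n) → Fin n → Maybe (Fin p)
  levelOf A x with any? (λ l → x ∈? A l)
  ... | yes (l , _) = just l
  ... | no  _       = nothing

  module _ {A : Fin p → Subset n} where

    levelOf≡just⇒∈ : ∀ {x l} → levelOf A x ≡ just l → x ∈ A l
    levelOf≡just⇒∈ {x} eq with any? (λ l → x ∈? A l)
    levelOf≡just⇒∈ refl | yes (_ , x∈) = x∈

    ∈⇒levelOf≡just : IsWeakSetComposition A → ∀ {x l} → x ∈ A l → levelOf A x ≡ just l
    ∈⇒levelOf≡just wsc {x} {l} x∈ with any? (λ l → x ∈? A l)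
    ... | yes (l′ , x∈′) = cong just (part-unique wsc x∈′ x∈)
    ... | no  none       = contradiction (l , x∈) none

  module Compositions (A : Fin m → Fin p → Subset n) (wsc : ∀ j → IsWeakSetComposition (A j)) where

    level : Fin m → Fin n → Maybe (Fin p)
    level j = levelOf (A j)

    Distinct : Set
    Distinct = ∀ i j → i ≢ j → ¬ (∀ k → A i k ≡ A j k)

    Separated : ℕ → Set
    Separated r = ∀ (k : Fin p) (I : Subset m) → ∣ I ∣ ≡ suc r →
      Σ (Fin m) λ i → Σ (Fin m) λ j → i ∈ I × j ∈ I × i ≢ j ×
        (A i k ≡ A j k ⊎ (A i k ∩ unionExcept k (A j) ≢ ⊥ × A j k ∩ unionExcept k (A i) ≢ ⊥))

    lies-above : ∀ {i j k l x} → (∀ l → l Fin.< k → A i l ≡ A j l) → x ∈ A i k → x ∈ A j l → l ≢ k → k Fin.< l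
    lies-above {i} {k = k} {l} agree x∈Aik x∈Ajl l≢k with <-cmp l k
    ... | tri< l<k _ _ = contradiction (part-unique (wsc i) (subst (_ ∈_) (sym (agree l l<k)) x∈Ajl) x∈Aik) l≢k
    ... | tri≈ _ l≡k _ = contradiction l≡k l≢k
    ... | tri> _ _ k<l = k<l

    overlap-above : ∀ {i j k} → (∀ l → l Fin.< k → A i l ≡ A j l) → A i k ∩ unionExcept k (A j) ≢ ⊥ →
                    ∃₂ λ x l → level i x ≡ just k × level j x ≡ just l × k Fin.< l
    overlap-above {i} {j} {k} agree meets =
      let x , x∈           = p≢⊥⇒Nonempty _ meets
          x∈Aik , x∈others = x∈p∩q⁻ (A i k) _ x∈
          l , l≢k , x∈Ajl  = ∈unionExcept⁻ k (A j) x∈others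
      in x , l , ∈⇒levelOf≡just (wsc i) x∈Aik , ∈⇒levelOf≡just (wsc j) x∈Ajl , lies-above agree x∈Aik x∈Ajl l≢k

    overlaps⇒crossing : ∀ {i j k} → (∀ l → l Fin.< k → A i l ≡ A j l) →
      A i k ∩ unionExcept k (A j) ≢ ⊥ → A j k ∩ unionExcept k (A i) ≢ ⊥ → ∃₂ (Crossing level i j)
    overlaps⇒crossing agree meetsᵢ meetsⱼ =
      let x , l  , ix≡k , jx≡l  , k<l  = overlap-above agree meetsᵢ
          y , l′ , jy≡k , iy≡l′ , k<l′ = overlap-above (λ l l<k → sym (agree l l<k)) meetsⱼ
      in x , y , subst₂ _⊏_ (sym ix≡k) (sym iy≡l′) (just⊏just k<l′)
               , subst₂ _⊏_ (sym jy≡k) (sym jx≡l) (just⊏just k<l)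

    noncrossing-bound : ∀ {r} → Distinct → Separated r → ∀ {J} → CrossingsWithin level ⊥ J → ∣ J ∣ ≤ r ^ p
    noncrossing-bound {r} distinct separated {J} noncrossing =
      product-pigeonhole (Vec.≡-dec Bool._≟_) r A J injective collide
      where
      injective : ∀ {i j} → i ∈ J → j ∈ J → (∀ k → A i k ≡ A j k) → i ≡ j
      injective {i} {j} _ _ same with i ≟ j
      ... | yes i≡j = i≡j
      ... | no  i≢j = contradiction same (distinct i j i≢j)
      collide : ∀ k I → I ⊆ J → ∣ I ∣ ≡ suc r → AgreeBelow A k I → Collision (λ i → A i k) I
      collide k I I⊆J ∣I∣≡ agree with separated k I ∣I∣≡
      ... | i , j , i∈I , j∈I , i≢j , inj₁ same = i , j , i∈I , j∈I , i≢j , same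
      ... | i , j , i∈I , j∈I , i≢j , inj₂ (meetsᵢ , meetsⱼ) =
        let _ , _ , crossing = overlaps⇒crossing (agree i∈I j∈I) meetsᵢ meetsⱼ
        in contradiction (noncrossing (I⊆J i∈I) (I⊆J j∈I) crossing) ∉⊥

    compatible-orderings : Fin m → ℕ
    compatible-orderings j = arrangements (Levels.admissible? (level j)) n ⊤

    compatible-orderings-count : ∀ j →
      compatible-orderings j * sumℕ (λ l → ∣ A j l ∣) ! ≡ n ! * prodℕ (λ l → ∣ A j l ∣ !)
    compatible-orderings-count j = begin
      compatible-orderings j * sumℕ (λ l → ∣ A j l ∣) !
        ≡⟨ cong (λ s → compatible-orderings j * s !)
                (trans (sum-cong-≗ {p} part-size) (sym (sumℕ≡∑ (λ l → ∣ A j l ∣)))) ⟨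
      compatible-orderings j * levelled ⊤ !
        ≡⟨ arrangements-count n ⊤ (∣⊤∣≡n n) ⟩
      n ! * ∏size! ⊤
        ≡⟨ cong (n ! *_) (prodℕ-cong (cong _! ∘ part-size)) ⟩
      n ! * prodℕ (λ l → ∣ A j l ∣ !) ∎
      where
      open ≡-Reasoning
      open Levels (level j)
      part-size : ∀ l → count-at ⊤ (just l) ≡ ∣ A j l ∣
      part-size l = trans (sum-cong-≗ {n} λ x →
          𝟙-⇔ (mk⇔ (levelOf≡just⇒∈ ∘ proj₂) (λ x∈ → ∈⊤ , ∈⇒levelOf≡just (wsc j) x∈))
              (x ∈? ⊤ ×-dec level j x ≟ᴹ just l) (x ∈? A j l))
        (sym (∣p∣≡∑𝟙 (A j l)))

    ∑-compatible-orderings≤ : ∀ {r} → Distinct → Separated r → ∑[ j < m ] compatible-orderings j ≤ n ! * r ^ p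
    ∑-compatible-orderings≤ {r} distinct separated = begin
      ∑[ j < m ] compatible-orderings j
        ≡⟨ sum-cong-≗ {m} (λ j → trans (cong (_* compatible-orderings j) (𝟙-yes (j ∈? ⊤) ∈⊤))
                                      (+-identityʳ (compatible-orderings j))) ⟨
      ∑[ j < m ] (𝟙 (j ∈? ⊤) * compatible-orderings j)
        ≤⟨ double-counting (λ j → Levels.admissible? (level j)) proj₁ (CrossingsWithin level)
             (crossings-hereditary level) (noncrossing-bound distinct separated) n ⊤ ⊤ (∣⊤∣≡n n) (λ _ _ _ → ∈⊤) ⟩
      n ! * r ^ p ∎
      where open ≤-Reasoning

open import Data.Nat using (ℕ; suc; _≥_; _^_)
open import Data.Fin using (Fin)
open import Data.Fin.Subset using (Subset; ⊥; _∩_; _∈_; ∣_∣)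
open import Data.Integer using (+_)
open import Data.Rational using (ℚ; _≤_; _/_)
open import Data.Product using (Σ; _×_; _,_)
open import Data.Sum using (_⊎_)
open import Relation.Binary.PropositionalEquality using (_≡_; _≢_)
open import Relation.Nullary using (¬_)

open import Data.Fin.Base using (zero; suc)
open import Data.Nat.Base as ℕ using (zero; NonZero; _+_; _*_; _!)
import Data.Nat.Properties as ℕ
open import Algebra.Properties.Semiring.Sum ℕ.+-*-semiring using (sum-syntax)
open import Data.Integer.Base as ℤ using ()
open import Data.Integer.Properties using (pos-*; pos-+)
import Data.Integer.Tactic.RingSolver as ℤ-Solver
open import Data.Rational.Base using (toℚᵘ) renaming (_+_ to _+ℚ_)
import Data.Rational.Properties as ℚ
open import Data.Rational.Unnormalised.Base as ℚᵘ using (mkℚᵘ; *≡*; *≤*)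
import Data.Rational.Unnormalised.Properties as ℚᵘ
open import Function.Base using (_∘_)
open import Relation.Binary.PropositionalEquality using (refl; sym; trans; cong; cong₂; subst₂)
open Counting.Compositions using (compatible-orderings; compatible-orderings-count; ∑-compatible-orderings≤)

toℚᵘ-/ : ∀ i d .{{_ : NonZero d}} → toℚᵘ (i / d) ℚᵘ.≃ i ℚᵘ./ d
toℚᵘ-/ i (suc d) = ℚ.toℚᵘ-fromℚᵘ (mkℚᵘ i d)

/-≡ : ∀ {i j} c d .{{_ : NonZero c}} .{{_ : NonZero d}} → i ℤ.* + d ≡ j ℤ.* + c → i / c ≡ j / d
/-≡ {i} {j} c@(suc _) d@(suc _) eq =
  ℚ.toℚᵘ-injective (ℚᵘ.≃-trans (toℚᵘ-/ i c) (ℚᵘ.≃-trans (*≡* eq) (ℚᵘ.≃-sym (toℚᵘ-/ j d))))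

/-≤ : ∀ {i j} c d .{{_ : NonZero c}} .{{_ : NonZero d}} → i ℤ.* + d ℤ.≤ j ℤ.* + c → i / c ≤ j / d
/-≤ {i} {j} c@(suc _) d@(suc _) le =
  ℚ.toℚᵘ-cancel-≤ (ℚᵘ.≤-respˡ-≃ (ℚᵘ.≃-sym (toℚᵘ-/ i c))
                  (ℚᵘ.≤-respʳ-≃ (ℚᵘ.≃-sym (toℚᵘ-/ j d)) (*≤* le)))

/-+ : ∀ a b d .{{_ : NonZero d}} → + a / d +ℚ + b / d ≡ + (a + b) / d
/-+ a b d@(suc _) = ℚ.toℚᵘ-injective (ℚᵘ.≃-trans (ℚ.toℚᵘ-homo-+ (+ a / d) (+ b / d))
  (ℚᵘ.≃-trans (ℚᵘ.+-cong (toℚᵘ-/ (+ a) d) (toℚᵘ-/ (+ b) d))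
  (ℚᵘ.≃-trans (*≡* cross) (ℚᵘ.≃-sym (toℚᵘ-/ (+ (a + b)) d)))))
  where
  distrib : ∀ x y z → (x ℤ.* z ℤ.+ y ℤ.* z) ℤ.* z ≡ (x ℤ.+ y) ℤ.* (z ℤ.* z)
  distrib = ℤ-Solver.solve-∀
  cross : (+ a ℤ.* + d ℤ.+ + b ℤ.* + d) ℤ.* + d ≡ + (a + b) ℤ.* + (d * d)
  cross = trans (distrib (+ a) (+ b) (+ d)) (cong₂ ℤ._*_ (sym (pos-+ a b)) (sym (pos-* d d)))

sumℚ-cong : ∀ {m} {f g : Fin m → ℚ} → (∀ j → f j ≡ g j) → sumℚ f ≡ sumℚ g
sumℚ-cong {zero}  f≡g = refl
sumℚ-cong {suc m} f≡g = cong₂ _+ℚ_ (f≡g zero) (sumℚ-cong (f≡g ∘ suc))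

sumℚ-/ : ∀ {m} (c : Fin m → ℕ) d .{{_ : NonZero d}} → sumℚ (λ j → + c j / d) ≡ + (∑[ j < m ] c j) / d
sumℚ-/ {zero}  c d = sym (ℚ.0/n≡0 d)
sumℚ-/ {suc m}  c d = trans (cong (+ c zero / d +ℚ_) (sumℚ-/ (c ∘ suc) d)) (/-+ (c zero) _ d)

∑-inverse-multinomials≤ : ∀ {m p} (a : Fin m → Fin p → ℕ) (c : Fin m → ℕ) D B .{{_ : NonZero D}} →
  (∀ j → c j * sumℕ (a j) ! ≡ D * prodℕ (λ l → a j l !)) → ∑[ j < m ] c j ℕ.≤ D * B →
  sumℚ (λ j → invMultinomial (a j)) ≤ + B / 1
∑-inverse-multinomials≤ {m} a c D B counts ∑c≤ = begin
  sumℚ (λ j → invMultinomial (a j))  ≡⟨ sumℚ-cong term ⟩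
  sumℚ (λ j → + c j / D)             ≡⟨ sumℚ-/ c D ⟩
  + (∑[ j < m ] c j) / D             ≤⟨ /-≤ {+ ∑c} {+ B} D 1
                                           (subst₂ ℤ._≤_ (pos-* ∑c 1) (pos-* B D) (ℤ.+≤+ ∑c*1≤B*D)) ⟩
  + B / 1                            ∎
  where
  open ℚ.≤-Reasoning
  ∑c = ∑[ j < m ] c j
  ∑c*1≤B*D : ∑c * 1 ℕ.≤ B * D
  ∑c*1≤B*D = ℕ.≤-trans (ℕ.≤-reflexive (ℕ.*-identityʳ _)) (ℕ.≤-trans ∑c≤ (ℕ.≤-reflexive (ℕ.*-comm D B)))
  term : ∀ j → invMultinomial (a j) ≡ + c j / D
  term j = /-≡ {+ Π} {+ c j} (S !) D {{S ℕ.!≢0}}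
    (trans (sym (pos-* Π D)) (trans (cong +_ (trans (ℕ.*-comm Π D) (sym (counts j)))) (pos-* (c j) (S !))))
    where
    S = sumℕ (a j)
    Π = prodℕ (λ l → a j l !)

theorem2p5 : (n p r m : ℕ) → p ≥ 2 → r ≥ 1 →
    (A : Fin m → Fin p → Subset n) →
    (∀ j → IsWeakSetComposition (A j)) →
    (∀ i j → i ≢ j → ¬ (∀ k → A i k ≡ A j k)) →
    (∀ (k : Fin p) (I : Subset m) → ∣ I ∣ ≡ suc r →
      Σ (Fin m) λ i → Σ (Fin m) λ j → i ∈ I × j ∈ I × i ≢ j ×
        (A i k ≡ A j k ⊎
          (A i k ∩ unionExcept k (A j) ≢ ⊥ × A j k ∩ unionExcept k (A i) ≢ ⊥))) →
    sumℚ (λ j → invMultinomial (λ l → ∣ A j l ∣)) ≤ (+ (r ^ p)) / 1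
theorem2p5 n p r m _ _ A wsc distinct separated =
  ∑-inverse-multinomials≤ (λ j l → ∣ A j l ∣) (compatible-orderings A wsc) (n !) (r ^ p) {{n ℕ.!≢0}}
    (compatible-orderings-count A wsc) (∑-compatible-orderings≤ A wsc distinct separated)
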